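{- Let $\varepsilon>0$ be sufficiently small and let $(\mathcal K,E_{\mathrm{adm}})$ be an $\varepsilon$-similar preclustering of a Correlation Clustering instance. Then for every non-singleton atom $K\in\mathcal K$, $$d_{\mathrm{cross}}(K)=2\cdot\mathrm{cost}(K)=\Omega(\varepsilon^{3}d_{\mathrm{adm}}(K)).$$ Moreover, if some optimal clustering $\mathrm{OPT}$ is $\varepsilon$-large with respect to $(\mathcal K,E_{\mathrm{adm}})$ and $|E_{\mathrm{adm}}|=O(\varepsilon^{ -12}\mathrm{cost}(\mathrm{OPT}))$, then $$d_{\mathrm{cross}}(V)=\sum_{v\in V}d_{\mathrm{cross}}(v)=O(\varepsilon^{ -12})\,\mathrm{cost}(\mathrm{OPT}).$$
   Context: Instance: vertex set $V$, every unordered pair labeled $+$edge or $-$edge; $E^+$ is the set of $+$edges (including all self-loops $uu$), $E^-$ the $-$edges. $d(v)$ is the number of $+$edges at $v$ (self-loop included); $d(v,C)$ the number of $+$edges from $v$ to $C$. For $S\subseteq V$, $\mathrm{cost}(S)=\frac12|E^+(S,V\setminus S)|+|E^-(S)|$ ($+$edges with exactly one endpoint in $S$; $-$edges with both endpoints in $S$). A clustering's cost is the number of $+$edges across clusters plus $-$edges within clusters; $\mathrm{OPT}$ is an optimal clustering. Preclustering: a pair $(\mathcal K,E_{\mathrm{adm}})$ where $\mathcal K$ is a family of disjoint subsets of $V$ each of size $\ge2$ (non-singleton atoms), $V_{\mathcal K}=\bigcup\mathcal K$, vertices outside $V_{\mathcal K}$ are singleton atoms, and $E_{\mathrm{adm}}$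 is a set of pairs (admissible pairs) each having at least one endpoint outside $V_{\mathcal K}$. $K(v)$ is the atom containing $v$ ($\{v\}$ if $v$ is a singleton atom). $N_{\mathrm{adm}}(v)$ is the set of $u$ with $(u,v)\in E_{\mathrm{adm}}$, $d_{\mathrm{adm}}(v)=|N_{\mathrm{adm}}(v)|$, $d_{\mathrm{adm}}(S)=\sum_{v\in S}d_{\mathrm{adm}}(v)$. A pair inside an atom is atomic; a pair neither atomic nor admissible is non-admissible. $\varepsilon$-similar: (a) $d_{\mathrm{adm}}(v)\le2\varepsilon^{ -3}d(v)$ for all $v$; (b) for every $uv\in E_{\mathrm{adm}}$, $d(u)\le2\varepsilon^{ -1}d(v)$ and $u,v$ have at least $\varepsilon\min\{d(u),d(v)\}$ common $+$neighbors $w$ that are degree similar to both (a pair $w\tilde w$ is degree similar if $\varepsilon d(w)\le d(\tilde w)\le d(w)/\varepsilon$); (c) for every atom $K\in\mathcal K$ and $v\in K$, $v$ is $+$adjacent to at least a $(1-O(\varepsilon))$-fraction of $K$ and has at most $O(\varepsilon|K|)$ $+$neighbors outside $K$. $\varepsilon$-large cluster $C$: does not break any atomic pair, contains no non-admissible pair, and if $|C|>1$ then $|C|\ge\varepsilon d(v)$ for all $v\in C$; a clustering is $\varepsilon$-large if all its clusters are. $d_{\mathrm{cross}}(v)=d(v)-1$ if $v$ is a singleton atom, and $d_{\mathrm{cross}}(v)=2\,\mathrm{cost}(K(v))/|K(v)|$ if $v$ lies in a non-singleton atom; $d_{\mathrm{cross}}(S)=\sum_{v\in S}d_{\mathrm{cross}}(v)$.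 -}

module Defs where

open import Data.Bool using (Bool; true; false; if_then_else_; _∧_; _∨_; not; T)
open import Data.Nat as ℕ using (ℕ; zero; suc; _∸_)
open import Data.Fin using (Fin; toℕ) renaming (zero to fz; suc to fs)
open import Data.Fin.Properties using () renaming (_≟_ to _≟F_)
open import Data.Maybe using (Maybe; just; nothing)
open import Data.Integer using (+_)
open import Data.Rational using (ℚ; 0ℚ; 1ℚ; _+_; _*_; _-_; _≤_; _<_; _≤ᵇ_; _⊓_; 1/_; _/_)
open import Data.Product using (_×_; Σ; ∃; _,_)
open import Data.Sum using (_⊎_)
open import Relation.Nullary using (does; ¬_)
open import Relation.Binary.PropositionalEquality using (_≡_)

sumℕ : ∀ {n} → (Fin n → ℕ) → ℕ
sumℕ {zero}  f = 0
sumℕ {suc n} f = f fz ℕ.+ sumℕ (λ i → f (fs i))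

sumℚ : ∀ {n} → (Fin n → ℚ) → ℚ
sumℚ {zero}  f = 0ℚ
sumℚ {suc n} f = f fz + sumℚ (λ i → f (fs i))

count : ∀ {n} → (Fin n → Bool) → ℕ
count p = sumℕ (λ i → if p i then 1 else 0)

whenℚ : Bool → ℚ → ℚ
whenℚ true  q = q
whenℚ false q = 0ℚ

toℚ : ℕ → ℚ
toℚ m = + m / 1

pow : ℚ → ℕ → ℚ
pow q zero    = 1ℚ
pow q (suc m) = q * pow q m

-- 1/m for m ≥ 1 (value at 0 is irrelevant: only used for atoms, of size ≥ 2)
invℕ : ℕ → ℚ
invℕ zero    = 0ℚ
invℕ (suc m) = + 1 / suc m

-- u < w as vertices (used to enumerate unordered pairs of distinct vertices)
_<V_ : ∀ {n} → Fin n → Fin n → Bool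
u <V w = toℕ u ℕ.<ᵇ toℕ w

_≡ᵇ_ : ∀ {n} → Fin n → Fin n → Bool
u ≡ᵇ w = does (u ≟F w)

isAtom : ∀ {k} → Maybe (Fin k) → Fin k → Bool
isAtom nothing  i = false
isAtom (just j) i = j ≡ᵇ i

record Instance (n : ℕ) : Set where
  field
    plus     : Fin n → Fin n → Bool
    plus-sym : ∀ u v → plus u v ≡ plus v u
    plus-refl : ∀ u → plus u u ≡ true
open Instance public

Subset : ℕ → Set
Subset n = Fin n → Bool

module _ {n : ℕ} (I : Instance n) where

  -- d(v): number of +edges at v (self-loop included)
  deg : Fin n → ℕ
  deg v = count (λ w → plus I v w)

  degTo : Fin n → Subset n → ℕ
  degTo v C = count (λ w → C w ∧ plus I v w)

  size : Subset n → ℕ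
  size S = count S

  plusCut : Subset n → ℕ
  plusCut S = sumℕ (λ u → count (λ w → S u ∧ not (S w) ∧ plus I u w))

  minusIn : Subset n → ℕ
  minusIn S = sumℕ (λ u → count (λ w → (u <V w) ∧ S u ∧ S w ∧ not (plus I u w)))

  cost : Subset n → ℚ
  cost S = (+ 1 / 2) * toℚ (plusCut S) + toℚ (minusIn S)

  degSim : ℚ → Fin n → Fin n → Bool
  degSim ε w w' = (ε * toℚ (deg w) ≤ᵇ toℚ (deg w')) ∧ (ε * toℚ (deg w') ≤ᵇ toℚ (deg w))

  -- Clusterings: a label for every vertex (labels in Fin n suffice to
  -- represent every partition of V).

  Clustering : Set
  Clustering = Fin n → Fin n

  clusterOf : Clustering → Fin n → Subset n
  clusterOf cl i v = cl v ≡ᵇ i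

  clCost : Clustering → ℕ
  clCost cl = sumℕ (λ u → count (λ w → (u <V w) ∧
                 ((plus I u w ∧ not (cl u ≡ᵇ cl w)) ∨ (not (plus I u w) ∧ (cl u ≡ᵇ cl w)))))

  Optimal : Clustering → Set
  Optimal cl = ∀ cl' → clCost cl ℕ.≤ clCost cl'

  -- The family 𝒦 of non-singleton atoms is
  -- given by k atom names and a partial map atom : V → Maybe (Fin k)
  -- (atom v ≡ nothing means v ∉ V_𝒦, i.e. v is a singleton atom); this
  -- makes the atoms disjoint.

  record Preclustering : Set where
    field
      k        : ℕ
      atom     : Fin n → Maybe (Fin k)
      adm      : Fin n → Fin n → Bool
      adm-sym  : ∀ u v → adm u v ≡ adm v u
      atom-big : ∀ (i : Fin k) → 2 ℕ.≤ count (λ v → isAtom (atom v) i)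
      adm-out  : ∀ u v → adm u v ≡ true → (atom u ≡ nothing) ⊎ (atom v ≡ nothing)

  module _ (P : Preclustering) where
    open Preclustering P

    atomSet : Fin k → Subset n
    atomSet i v = isAtom (atom v) i

    K : Fin n → Subset n
    K v with atom v
    ... | nothing = λ w → w ≡ᵇ v
    ... | just i  = atomSet i

    atomic : Fin n → Fin n → Bool
    atomic u v = K u v

    dAdm : Fin n → ℕ
    dAdm v = count (λ u → adm u v)

    dAdmSet : Subset n → ℕ
    dAdmSet S = sumℕ (λ v → if S v then dAdm v else 0)

    -- |E_adm| (unordered pairs; a pair uu is counted once)
    numAdm : ℕ
    numAdm = sumℕ (λ u → count (λ w → (u <V w ∨ u ≡ᵇ w) ∧ adm u w))

    dCross : Fin n → ℚ
    dCross v with atom v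
    ... | nothing = toℚ (deg v) - 1ℚ
    ... | just i  = (toℚ 2 * cost (atomSet i)) * invℕ (size (atomSet i))

    dCrossSet : Subset n → ℚ
    dCrossSet S = sumℚ (λ v → whenℚ (S v) (dCross v))

    SimA : ℚ → Set
    SimA ε = ∀ v → pow ε 3 * toℚ (dAdm v) ≤ toℚ 2 * toℚ (deg v)

    SimB : ℚ → Set
    SimB ε = ∀ u v → adm u v ≡ true →
      (ε * toℚ (deg u) ≤ toℚ 2 * toℚ (deg v)) ×
      (ε * (toℚ (deg u) ⊓ toℚ (deg v)) ≤
         toℚ (count (λ w → plus I u w ∧ plus I v w ∧ degSim ε w u ∧ degSim ε w v)))

    SimC : ℚ → ℚ → Set
    SimC c₀ ε = ∀ (i : Fin k) v → atomSet i v ≡ true →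
      ((1ℚ - c₀ * ε) * toℚ (size (atomSet i)) ≤ toℚ (degTo v (atomSet i))) ×
      (toℚ (degTo v (λ w → not (atomSet i w))) ≤ c₀ * ε * toℚ (size (atomSet i)))

    -- ε-similarity; the O(ε) in condition (c) is c₀ · ε for a constant c₀
    Similar : ℚ → ℚ → Set
    Similar c₀ ε = SimA ε × SimB ε × SimC c₀ ε

    LargeCluster : ℚ → Subset n → Set
    LargeCluster ε C =
      (∀ u v → C u ≡ true → atomic u v ≡ true → C v ≡ true) ×
      (∀ u v → C u ≡ true → C v ≡ true → (atomic u v ≡ true) ⊎ (adm u v ≡ true)) ×
      (1 ℕ.< size C → ∀ v → C v ≡ true → ε * toℚ (deg v) ≤ toℚ (size C))

    Large : ℚ → Clustering → Set
    Large ε cl = ∀ i → LargeCluster ε (clusterOf cl i)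

{-# OPTIONS --safe #-}

-- Let K be an atom and v ∈ K. Condition (c) makes every vertex of K have degree between |K|/2 and 2|K|,
-- and an admissible partner u of v lies outside K. By condition (b), u and v have at least ε²|K|/4
-- common neighbours w that are degree similar to v. Such a w inside K gives a cut edge uw of K; a w
-- outside K gives a cut edge vw of K, and since d(w) ≤ d(v)/ε, each cut edge vw is counted at most d(v)/ε
-- times as u varies. Summing over v ∈ K gives ε³|K| d_adm(K) ≤ 12|K| |E⁺(K, V∖K)| ≤ 24|K| cost(K).
-- For the global bound, d_cross(V) is at most the number of +edges at singleton atoms plus 2 cost(K) summed
-- over atoms. Charge each of these pairs to the ε-large clustering: a +edge that leaves its atom is either
-- cut by the clustering or lies inside one of its clusters, hence is admissible; a −edge inside an atom lies
-- inside a cluster. Hence d_cross(V) ≤ 6 cost + 2 |E_adm|.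

module Submission where

open import Algebra.Bundles using (CommutativeMonoid)
import Algebra.Properties.CommutativeSemigroup as CommSemigroupProperties
open import Data.Bool using (Bool; true; false; if_then_else_; _∧_; _∨_; not; T)
open import Data.Bool.Properties using (T-∧; T-≡; ∧-zeroʳ; ∧-conicalˡ; ∧-conicalʳ; not-injective; not-¬)
open import Data.Empty using (⊥-elim)
open import Data.Fin using (Fin) renaming (zero to fz; suc to fs)
import Data.Fin.Properties as Fin
import Data.Integer as ℤ
import Data.Integer.Properties as ℤ
open import Data.Maybe using (Maybe; just; nothing; is-nothing)
open import Data.Nat as ℕ using (ℕ; zero; suc; z≤n)
import Data.Nat.Properties as ℕ
open import Data.Nat.Tactic.RingSolver using (solve-∀)
open import Data.Product using (Σ; _×_; _,_; proj₁; proj₂)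
open import Data.Rational
  using (ℚ; 0ℚ; 1ℚ; _+_; _*_; _-_; -_; _/_; 1/_; _⊓_; _≤_; _<_; _>_; toℚᵘ; Positive; NonZero; positive; nonNegative)
open import Data.Rational.Properties
open import Data.Rational.Solver using (module +-*-Solver)
import Data.Rational.Unnormalised as ℚᵘ
import Data.Rational.Unnormalised.Properties as ℚᵘ
open import Data.Sum using (_⊎_; inj₁; inj₂)
open import Data.Unit using (tt)
open import Function using (_∘_)
open import Function.Bundles using (Equivalence)
open import Relation.Binary.Definitions using (tri<; tri≈; tri>)
open import Relation.Binary.PropositionalEquality
open import Relation.Nullary using (Dec; yes; no)
open import Relation.Nullary.Decidable using (dec-true; dec-false)
open import Defs

open +-*-Solver using (solve; _:=_; con; _:+_; _:-_; _:*_)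
open CommSemigroupProperties ℕ.+-commutativeSemigroup using () renaming (interchange to ℕ-+-interchange)
open CommSemigroupProperties (CommutativeMonoid.commutativeSemigroup +-0-commutativeMonoid)
  using () renaming (interchange to +-interchange)
module ℚ* = CommSemigroupProperties (CommutativeMonoid.commutativeSemigroup *-1-commutativeMonoid)

toℚᵘ-toℚ : ∀ m → toℚᵘ (toℚ m) ℚᵘ.≃ ℚᵘ.mkℚᵘ (ℤ.+ m) 0
toℚᵘ-toℚ m = toℚᵘ-fromℚᵘ (ℚᵘ.mkℚᵘ (ℤ.+ m) 0)

toℚ-+ : ∀ m n → toℚ (m ℕ.+ n) ≡ toℚ m + toℚ n
toℚ-+ m n = toℚᵘ-injective (begin
  toℚᵘ (toℚ (m ℕ.+ n))                       ≈⟨ toℚᵘ-toℚ (m ℕ.+ n) ⟩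
  ℚᵘ.mkℚᵘ (ℤ.+ (m ℕ.+ n)) 0                  ≈⟨ ℚᵘ.*≡* numerators ⟩
  ℚᵘ.mkℚᵘ (ℤ.+ m) 0 ℚᵘ.+ ℚᵘ.mkℚᵘ (ℤ.+ n) 0  ≈⟨ ℚᵘ.+-cong (toℚᵘ-toℚ m) (toℚᵘ-toℚ n) ⟨
  toℚᵘ (toℚ m) ℚᵘ.+ toℚᵘ (toℚ n)             ≈⟨ toℚᵘ-homo-+ (toℚ m) (toℚ n) ⟨
  toℚᵘ (toℚ m + toℚ n)                       ∎)
  where
  open ℚᵘ.≃-Reasoning
  numerators : ℤ.+ (m ℕ.+ n) ℤ.* ℤ.+ 1 ≡ (ℤ.+ m ℤ.* ℤ.+ 1 ℤ.+ ℤ.+ n ℤ.* ℤ.+ 1) ℤ.* ℤ.+ 1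
  numerators = cong (ℤ._* ℤ.+ 1) (trans (ℤ.pos-+ m n)
    (sym (cong₂ ℤ._+_ (ℤ.*-identityʳ (ℤ.+ m)) (ℤ.*-identityʳ (ℤ.+ n)))))

toℚ-* : ∀ m n → toℚ (m ℕ.* n) ≡ toℚ m * toℚ n
toℚ-* m n = toℚᵘ-injective (begin
  toℚᵘ (toℚ (m ℕ.* n))                       ≈⟨ toℚᵘ-toℚ (m ℕ.* n) ⟩
  ℚᵘ.mkℚᵘ (ℤ.+ (m ℕ.* n)) 0                  ≈⟨ ℚᵘ.*≡* (cong (ℤ._* ℤ.+ 1) (ℤ.pos-* m n)) ⟩
  ℚᵘ.mkℚᵘ (ℤ.+ m) 0 ℚᵘ.* ℚᵘ.mkℚᵘ (ℤ.+ n) 0  ≈⟨ ℚᵘ.*-cong (toℚᵘ-toℚ m) (toℚᵘ-toℚ n) ⟨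
  toℚᵘ (toℚ m) ℚᵘ.* toℚᵘ (toℚ n)             ≈⟨ toℚᵘ-homo-* (toℚ m) (toℚ n) ⟨
  toℚᵘ (toℚ m * toℚ n)                       ∎)
  where open ℚᵘ.≃-Reasoning

toℚ-mono-≤ : ∀ {m n} → m ℕ.≤ n → toℚ m ≤ toℚ n
toℚ-mono-≤ {m} {n} m≤n = toℚᵘ-cancel-≤
  (ℚᵘ.≤-respˡ-≃ (ℚᵘ.≃-sym (toℚᵘ-toℚ m)) (ℚᵘ.≤-respʳ-≃ (ℚᵘ.≃-sym (toℚᵘ-toℚ n))
    (ℚᵘ.*≤* (ℤ.*-monoʳ-≤-nonNeg (ℤ.+ 1) (ℤ.+≤+ m≤n)))))

toℚ-nonNeg : ∀ m → 0ℚ ≤ toℚ m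
toℚ-nonNeg m = toℚ-mono-≤ {0} {m} z≤n

toℚ-*-invℕ : ∀ m → toℚ (suc m) * invℕ (suc m) ≡ 1ℚ
toℚ-*-invℕ m = toℚᵘ-injective (begin
  toℚᵘ (toℚ (suc m) * invℕ (suc m))            ≈⟨ toℚᵘ-homo-* (toℚ (suc m)) (invℕ (suc m)) ⟩
  toℚᵘ (toℚ (suc m)) ℚᵘ.* toℚᵘ (invℕ (suc m))  ≈⟨ ℚᵘ.*-cong (toℚᵘ-toℚ (suc m)) (toℚᵘ-fromℚᵘ (ℚᵘ.mkℚᵘ (ℤ.+ 1) m)) ⟩
  ℚᵘ.mkℚᵘ (ℤ.+ suc m) 0 ℚᵘ.* ℚᵘ.mkℚᵘ (ℤ.+ 1) m ≈⟨ ℚᵘ.*≡* (cong (λ x → ℤ.+ suc x) m*1*1≡m+0+0) ⟩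
  ℚᵘ.1ℚᵘ                                       ∎)
  where
  open ℚᵘ.≃-Reasoning
  m*1*1≡m+0+0 : m ℕ.* 1 ℕ.* 1 ≡ m ℕ.+ 0 ℕ.+ 0
  m*1*1≡m+0+0 = trans (ℕ.*-identityʳ (m ℕ.* 1)) (trans (ℕ.*-identityʳ m)
    (sym (trans (ℕ.+-identityʳ (m ℕ.+ 0)) (ℕ.+-identityʳ m))))

*-invℕ-cancelˡ : ∀ {m} c → 1 ℕ.≤ m → toℚ m * (c * invℕ m) ≡ c
*-invℕ-cancelˡ {suc m} c _ = begin
  toℚ (suc m) * (c * invℕ (suc m))  ≡⟨ ℚ*.x∙yz≈y∙xz (toℚ (suc m)) c (invℕ (suc m)) ⟩
  c * (toℚ (suc m) * invℕ (suc m))  ≡⟨ cong (c *_) (toℚ-*-invℕ m) ⟩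
  c * 1ℚ                            ≡⟨ *-identityʳ c ⟩
  c                                 ∎
  where open ≡-Reasoning

toℚ-+-*ʳ : ∀ m n x → toℚ (m ℕ.+ n) * x ≡ toℚ m * x + toℚ n * x
toℚ-+-*ʳ m n x = trans (cong (_* x) (toℚ-+ m n)) (*-distribʳ-+ x (toℚ m) (toℚ n))

toℚ-*-+-* : ∀ a b c d → toℚ (a ℕ.* b ℕ.+ c ℕ.* d) ≡ toℚ a * toℚ b + toℚ c * toℚ d
toℚ-*-+-* a b c d = trans (toℚ-+ (a ℕ.* b) (c ℕ.* d)) (cong₂ _+_ (toℚ-* a b) (toℚ-* c d))

*-monoˡ-≤-nonNeg′ : ∀ {r p q} → 0ℚ ≤ r → p ≤ q → r * p ≤ r * q
*-monoˡ-≤-nonNeg′ {r} 0≤r = *-monoˡ-≤-nonNeg r {{nonNegative 0≤r}}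

*-monoʳ-≤-nonNeg′ : ∀ {r p q} → 0ℚ ≤ r → p ≤ q → p * r ≤ q * r
*-monoʳ-≤-nonNeg′ {r} 0≤r = *-monoʳ-≤-nonNeg r {{nonNegative 0≤r}}

*-nonNeg : ∀ {p q} → 0ℚ ≤ p → 0ℚ ≤ q → 0ℚ ≤ p * q
*-nonNeg {p} {q} 0≤p 0≤q = subst (_≤ p * q) (*-zeroˡ q) (*-monoʳ-≤-nonNeg′ 0≤q 0≤p)

≤-+-nonNeg : ∀ {p q} → 0ℚ ≤ q → p ≤ p + q
≤-+-nonNeg {p} {q} 0≤q = subst (_≤ p + q) (+-identityʳ p) (+-monoʳ-≤ p 0≤q)

*-≤-of-≤1 : ∀ {r p} → 0ℚ ≤ p → r ≤ 1ℚ → r * p ≤ p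
*-≤-of-≤1 {r} {p} 0≤p r≤1 = subst (r * p ≤_) (*-identityˡ p) (*-monoʳ-≤-nonNeg′ 0≤p r≤1)

p≤q⇒0≤q-p : ∀ {p q} → p ≤ q → 0ℚ ≤ q - p
p≤q⇒0≤q-p {p} {q} p≤q = subst (_≤ q - p) (+-inverseʳ p) (+-monoˡ-≤ (- p) p≤q)

≤-+⇒-≤ : ∀ {p q r} → p ≤ r + q → p - r ≤ q
≤-+⇒-≤ {p} {q} {r} p≤r+q = subst (p - r ≤_) (solve 2 (λ r q → r :+ q :- r := q) refl r q) (+-monoˡ-≤ (- r) p≤r+q)

pow-nonNeg : ∀ {p} → 0ℚ ≤ p → ∀ m → 0ℚ ≤ pow p m
pow-nonNeg 0≤p zero    = toℚ-nonNeg 1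
pow-nonNeg 0≤p (suc m) = *-nonNeg 0≤p (pow-nonNeg 0≤p m)

pow-≤1 : ∀ {p} → 0ℚ ≤ p → p ≤ 1ℚ → ∀ m → pow p m ≤ 1ℚ
pow-≤1 0≤p p≤1 zero    = ≤-refl
pow-≤1 0≤p p≤1 (suc m) = ≤-trans (*-≤-of-≤1 (pow-nonNeg 0≤p m) p≤1) (pow-≤1 0≤p p≤1 m)

ε*s≤4*[a⊓b] : ∀ {ε s a b} → 0ℚ ≤ ε → ε ≤ 1ℚ → 0ℚ ≤ s → 0ℚ ≤ a →
         s ≤ toℚ 2 * a → ε * a ≤ toℚ 2 * b → ε * s ≤ toℚ 4 * (a ⊓ b)
ε*s≤4*[a⊓b] {ε} {s} {a} {b} 0≤ε ε≤1 0≤s 0≤a s≤2a εa≤2b with ⊓-sel a b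
... | inj₁ a⊓b≡a rewrite a⊓b≡a = begin
  ε * s                     ≤⟨ *-≤-of-≤1 0≤s ε≤1 ⟩
  s                         ≤⟨ s≤2a ⟩
  toℚ 2 * a                 ≤⟨ ≤-+-nonNeg (*-nonNeg (toℚ-nonNeg 2) 0≤a) ⟩
  toℚ 2 * a + toℚ 2 * a     ≡⟨ solve 1 (λ a → con (toℚ 2) :* a :+ con (toℚ 2) :* a := con (toℚ 4) :* a) refl a ⟩
  toℚ 4 * a                 ∎
  where open ≤-Reasoning
... | inj₂ a⊓b≡b rewrite a⊓b≡b = begin
  ε * s                     ≤⟨ *-monoˡ-≤-nonNeg′ 0≤ε s≤2a ⟩
  ε * (toℚ 2 * a)           ≡⟨ solve 2 (λ ε a → ε :* (con (toℚ 2) :* a) := con (toℚ 2) :* (ε :* a)) refl ε a ⟩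
  toℚ 2 * (ε * a)           ≤⟨ *-monoˡ-≤-nonNeg′ (toℚ-nonNeg 2) εa≤2b ⟩
  toℚ 2 * (toℚ 2 * b)       ≡⟨ solve 1 (λ b → con (toℚ 2) :* (con (toℚ 2) :* b) := con (toℚ 4) :* b) refl b ⟩
  toℚ 4 * b                 ∎
  where open ≤-Reasoning

sumℕ-cong : ∀ {n} {f g : Fin n → ℕ} → (∀ i → f i ≡ g i) → sumℕ f ≡ sumℕ g
sumℕ-cong {zero}  f≗g = refl
sumℕ-cong {suc n} f≗g = cong₂ ℕ._+_ (f≗g fz) (sumℕ-cong (f≗g ∘ fs))

sumℕ-mono-≤ : ∀ {n} {f g : Fin n → ℕ} → (∀ i → f i ℕ.≤ g i) → sumℕ f ℕ.≤ sumℕ g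
sumℕ-mono-≤ {zero}  f≤g = z≤n
sumℕ-mono-≤ {suc n} f≤g = ℕ.+-mono-≤ (f≤g fz) (sumℕ-mono-≤ (f≤g ∘ fs))

sumℕ-zero : ∀ n → sumℕ {n} (λ _ → 0) ≡ 0
sumℕ-zero zero    = refl
sumℕ-zero (suc n) = sumℕ-zero n

sumℕ-+ : ∀ {n} (f g : Fin n → ℕ) → sumℕ (λ i → f i ℕ.+ g i) ≡ sumℕ f ℕ.+ sumℕ g
sumℕ-+ {zero}  f g = refl
sumℕ-+ {suc n} f g = trans (cong (f fz ℕ.+ g fz ℕ.+_) (sumℕ-+ (f ∘ fs) (g ∘ fs)))
  (ℕ-+-interchange (f fz) (g fz) (sumℕ (f ∘ fs)) (sumℕ (g ∘ fs)))

sumℕ-*ˡ : ∀ {n} c (f : Fin n → ℕ) → sumℕ (λ i → c ℕ.* f i) ≡ c ℕ.* sumℕ f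
sumℕ-*ˡ {zero}  c f = sym (ℕ.*-zeroʳ c)
sumℕ-*ˡ {suc n} c f = trans (cong (c ℕ.* f fz ℕ.+_) (sumℕ-*ˡ c (f ∘ fs)))
  (sym (ℕ.*-distribˡ-+ c (f fz) (sumℕ (f ∘ fs))))

sumℕ-comm : ∀ {m n} (f : Fin m → Fin n → ℕ) →
            sumℕ (λ i → sumℕ (f i)) ≡ sumℕ (λ j → sumℕ (λ i → f i j))
sumℕ-comm {zero}  {n} f = sym (sumℕ-zero n)
sumℕ-comm {suc m} {n} f = trans (cong (sumℕ (f fz) ℕ.+_) (sumℕ-comm (f ∘ fs)))
  (sym (sumℕ-+ (f fz) (λ j → sumℕ (λ i → f (fs i) j))))

sumℕ-≡ᵇ : ∀ {n} (j : Fin n) (g : Fin n → ℕ) → sumℕ (λ i → if j ≡ᵇ i then g i else 0) ≡ g j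
sumℕ-≡ᵇ {suc n} fz     g = trans (cong (g fz ℕ.+_) (sumℕ-zero n)) (ℕ.+-identityʳ (g fz))
sumℕ-≡ᵇ {suc n} (fs j) g = sumℕ-≡ᵇ j (g ∘ fs)

𝟙[_] : Bool → ℕ
𝟙[ b ] = if b then 1 else 0

count-cong : ∀ {n} {p q : Fin n → Bool} → (∀ i → p i ≡ q i) → count p ≡ count q
count-cong p≗q = sumℕ-cong (cong 𝟙[_] ∘ p≗q)

count-false : ∀ {n} {p : Fin n → Bool} → (∀ i → p i ≡ false) → count p ≡ 0
count-false {n} p≗false = trans (count-cong p≗false) (sumℕ-zero n)

count-≤-+ : ∀ {n} {p q r : Fin n → Bool} → (∀ i → T (p i) → T (q i) ⊎ T (r i)) →
            count p ℕ.≤ count q ℕ.+ count r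
count-≤-+ {p = p} {q} {r} p⇒q∨r =
  ℕ.≤-trans (sumℕ-mono-≤ (λ i → 𝟙-≤-+ (p i) (q i) (r i) (p⇒q∨r i))) (ℕ.≤-reflexive (sumℕ-+ (𝟙[_] ∘ q) (𝟙[_] ∘ r)))
  where
  𝟙-≤-+ : ∀ a b c → (T a → T b ⊎ T c) → 𝟙[ a ] ℕ.≤ 𝟙[ b ] ℕ.+ 𝟙[ c ]
  𝟙-≤-+ false b     c     _ = z≤n
  𝟙-≤-+ true  true  c     _ = ℕ.s≤s z≤n
  𝟙-≤-+ true  false true  _ = ℕ.≤-refl
  𝟙-≤-+ true  false false h with h tt
  ... | inj₁ ()
  ... | inj₂ ()

count-mono-≤ : ∀ {n} {p q : Fin n → Bool} → (∀ i → T (p i) → T (q i)) → count p ℕ.≤ count q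
count-mono-≤ {p = p} {q} p⇒q = sumℕ-mono-≤ (λ i → 𝟙-mono (p i) (q i) (p⇒q i))
  where
  𝟙-mono : ∀ a b → (T a → T b) → 𝟙[ a ] ℕ.≤ 𝟙[ b ]
  𝟙-mono false b     _ = z≤n
  𝟙-mono true  true  _ = ℕ.≤-refl
  𝟙-mono true  false h = ⊥-elim (h tt)

count-split : ∀ {n} (q p : Fin n → Bool) →
              count p ≡ count (λ i → q i ∧ p i) ℕ.+ count (λ i → not (q i) ∧ p i)
count-split q p = trans (sumℕ-cong (λ i → 𝟙-split (q i) (p i)))
  (sumℕ-+ (λ i → 𝟙[ q i ∧ p i ]) (λ i → 𝟙[ not (q i) ∧ p i ]))
  where
  𝟙-split : ∀ b c → 𝟙[ c ] ≡ 𝟙[ b ∧ c ] ℕ.+ 𝟙[ not b ∧ c ]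
  𝟙-split true  c = sym (ℕ.+-identityʳ 𝟙[ c ])
  𝟙-split false c = refl

count-≡ᵇ : ∀ {n} (j : Fin n) → count (j ≡ᵇ_) ≡ 1
count-≡ᵇ j = sumℕ-≡ᵇ j (λ _ → 1)

𝟙-≤ : ∀ b {m} → (b ≡ true → 1 ℕ.≤ m) → 𝟙[ b ] ℕ.≤ m
𝟙-≤ true  1≤m = 1≤m refl
𝟙-≤ false _   = z≤n

sumℕ² : ∀ {m n} → (Fin m → Fin n → ℕ) → ℕ
sumℕ² f = sumℕ (λ u → sumℕ (f u))

sumℕ²-+ : ∀ {m n} (f g : Fin m → Fin n → ℕ) → sumℕ² (λ u w → f u w ℕ.+ g u w) ≡ sumℕ² f ℕ.+ sumℕ² g
sumℕ²-+ f g = trans (sumℕ-cong (λ u → sumℕ-+ (f u) (g u))) (sumℕ-+ (λ u → sumℕ (f u)) (λ u → sumℕ (g u)))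

sumℕ²-*ˡ : ∀ {m n} c (f : Fin m → Fin n → ℕ) → sumℕ² (λ u w → c ℕ.* f u w) ≡ c ℕ.* sumℕ² f
sumℕ²-*ˡ c f = trans (sumℕ-cong (λ u → sumℕ-*ˡ c (f u))) (sumℕ-*ˡ c (λ u → sumℕ (f u)))

sumℕ²-mono-≤ : ∀ {m n} {f g : Fin m → Fin n → ℕ} → (∀ u w → f u w ℕ.≤ g u w) → sumℕ² f ℕ.≤ sumℕ² g
sumℕ²-mono-≤ f≤g = sumℕ-mono-≤ (λ u → sumℕ-mono-≤ (f≤g u))

sumℕ²-transpose : ∀ {n} (f : Fin n → Fin n → ℕ) → sumℕ² (λ u w → f w u) ≡ sumℕ² f
sumℕ²-transpose f = sumℕ-comm (λ u w → f w u)

sumℚ-cong : ∀ {n} {f g : Fin n → ℚ} → (∀ i → f i ≡ g i) → sumℚ f ≡ sumℚ g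
sumℚ-cong {zero}  f≗g = refl
sumℚ-cong {suc n} f≗g = cong₂ _+_ (f≗g fz) (sumℚ-cong (f≗g ∘ fs))

sumℚ-mono-≤ : ∀ {n} {f g : Fin n → ℚ} → (∀ i → f i ≤ g i) → sumℚ f ≤ sumℚ g
sumℚ-mono-≤ {zero}  f≤g = ≤-refl
sumℚ-mono-≤ {suc n} f≤g = +-mono-≤ (f≤g fz) (sumℚ-mono-≤ (f≤g ∘ fs))

sumℚ-zero : ∀ n → sumℚ {n} (λ _ → 0ℚ) ≡ 0ℚ
sumℚ-zero zero    = refl
sumℚ-zero (suc n) = trans (+-identityˡ _) (sumℚ-zero n)

sumℚ-+ : ∀ {n} (f g : Fin n → ℚ) → sumℚ (λ i → f i + g i) ≡ sumℚ f + sumℚ g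
sumℚ-+ {zero}  f g = refl
sumℚ-+ {suc n} f g = trans (cong ((f fz + g fz) +_) (sumℚ-+ (f ∘ fs) (g ∘ fs)))
  (+-interchange (f fz) (g fz) (sumℚ (f ∘ fs)) (sumℚ (g ∘ fs)))

sumℚ-comm : ∀ {m n} (f : Fin m → Fin n → ℚ) →
            sumℚ (λ i → sumℚ (f i)) ≡ sumℚ (λ j → sumℚ (λ i → f i j))
sumℚ-comm {zero}  {n} f = sym (sumℚ-zero n)
sumℚ-comm {suc m} {n} f = trans (cong (sumℚ (f fz) +_) (sumℚ-comm (f ∘ fs)))
  (sym (sumℚ-+ (f fz) (λ j → sumℚ (λ i → f (fs i) j))))

toℚ-sumℕ : ∀ {n} (f : Fin n → ℕ) → toℚ (sumℕ f) ≡ sumℚ (toℚ ∘ f)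
toℚ-sumℕ {zero}  f = refl
toℚ-sumℕ {suc n} f = trans (toℚ-+ (f fz) (sumℕ (f ∘ fs))) (cong (toℚ (f fz) +_) (toℚ-sumℕ (f ∘ fs)))

sumℚ-whenℚ : ∀ {n} (p : Fin n → Bool) q → sumℚ (λ i → whenℚ (p i) q) ≡ toℚ (count p) * q
sumℚ-whenℚ {zero}  p q = sym (*-zeroˡ q)
sumℚ-whenℚ {suc n} p q = begin
  whenℚ (p fz) q + sumℚ (λ i → whenℚ (p (fs i)) q)  ≡⟨ cong₂ _+_ (whenℚ≡𝟙* (p fz)) (sumℚ-whenℚ (p ∘ fs) q) ⟩
  toℚ 𝟙[ p fz ] * q + toℚ (count (p ∘ fs)) * q     ≡⟨ toℚ-+-*ʳ 𝟙[ p fz ] (count (p ∘ fs)) q ⟨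
  toℚ (count p) * q                                  ∎
  where
  open ≡-Reasoning
  whenℚ≡𝟙* : ∀ b → whenℚ b q ≡ toℚ 𝟙[ b ] * q
  whenℚ≡𝟙* true  = sym (*-identityˡ q)
  whenℚ≡𝟙* false = sym (*-zeroˡ q)

sumℕ-scaled-≤ : ∀ {n} (f g : Fin n → ℕ) {x y : ℚ} → (∀ i → toℚ (f i) * x ≤ toℚ (g i) * y) →
                toℚ (sumℕ f) * x ≤ toℚ (sumℕ g) * y
sumℕ-scaled-≤ {zero}  f g {x} {y} _   = ≤-reflexive (trans (*-zeroˡ x) (sym (*-zeroˡ y)))
sumℕ-scaled-≤ {suc n} f g {x} {y} f≤g = begin
  toℚ (f fz ℕ.+ sumℕ (f ∘ fs)) * x             ≡⟨ toℚ-+-*ʳ (f fz) (sumℕ (f ∘ fs)) x ⟩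
  toℚ (f fz) * x + toℚ (sumℕ (f ∘ fs)) * x     ≤⟨ +-mono-≤ (f≤g fz) (sumℕ-scaled-≤ (f ∘ fs) (g ∘ fs) (f≤g ∘ fs)) ⟩
  toℚ (g fz) * y + toℚ (sumℕ (g ∘ fs)) * y     ≡⟨ toℚ-+-*ʳ (g fz) (sumℕ (g ∘ fs)) y ⟨
  toℚ (g fz ℕ.+ sumℕ (g ∘ fs)) * y             ∎
  where open ≤-Reasoning

sumℕ-scaled-≤′ : ∀ {n} (f g : Fin n → ℕ) {x : ℚ} → (∀ i → toℚ (f i) * x ≤ toℚ (g i)) →
                 toℚ (sumℕ f) * x ≤ toℚ (sumℕ g)
sumℕ-scaled-≤′ f g {x} f≤g = subst (toℚ (sumℕ f) * x ≤_) (*-identityʳ (toℚ (sumℕ g)))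
  (sumℕ-scaled-≤ f g (λ i → subst (toℚ (f i) * x ≤_) (sym (*-identityʳ (toℚ (g i)))) (f≤g i)))

toℚ-if-*-≤ : ∀ b m {x y} → 0ℚ ≤ y → (b ≡ true → toℚ m * x ≤ y) → toℚ (if b then m else 0) * x ≤ y
toℚ-if-*-≤ true  m     _   m*x≤y = m*x≤y refl
toℚ-if-*-≤ false m {x} 0≤y _     = subst (_≤ _) (sym (*-zeroˡ x)) 0≤y

≡ᵇ⇒≡ : ∀ {m} {a b : Fin m} → a ≡ᵇ b ≡ true → a ≡ b
≡ᵇ⇒≡ {a = a} {b} eq with a Fin.≟ b
... | yes a≡b = a≡b
... | no  _   with () ← eq

≡ᵇ-false⇒≢ : ∀ {m} {a b : Fin m} → a ≡ᵇ b ≡ false → a ≢ b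
≡ᵇ-false⇒≢ {a = a} {b} a≢ᵇb a≡b = not-¬ (dec-true (a Fin.≟ b) a≡b) a≢ᵇb

≢⇒<V : ∀ {m} {u w : Fin m} → u ≢ w → (u <V w) ≡ true ⊎ (w <V u) ≡ true
≢⇒<V {u = u} {w} u≢w with Fin.<-cmp u w
... | tri< u<w _   _   = inj₁ (Equivalence.to T-≡ (ℕ.<⇒<ᵇ u<w))
... | tri≈ _   u≡w _   = ⊥-elim (u≢w u≡w)
... | tri> _   _   w<u = inj₂ (Equivalence.to T-≡ (ℕ.<⇒<ᵇ w<u))

module _ {n} (I : Instance n) where

  deg≡degTo+degToᶜ : ∀ v C → deg I v ≡ degTo I v C ℕ.+ degTo I v (not ∘ C)
  deg≡degTo+degToᶜ v C = count-split C (plus I v)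

  degTo≤size : ∀ v C → degTo I v C ℕ.≤ size I C
  degTo≤size v C = count-mono-≤ {q = C} (λ w → proj₁ ∘ Equivalence.to (T-∧ {C w}))

  degTo≤deg : ∀ v C → degTo I v C ℕ.≤ deg I v
  degTo≤deg v C = count-mono-≤ {q = plus I v} (λ w → proj₂ ∘ Equivalence.to (T-∧ {C w}))

  sum-degTo : ∀ C → sumℕ (λ u → degTo I u C) ≡ sumℕ (λ w → if C w then deg I w else 0)
  sum-degTo C = trans (sumℕ-comm (λ u w → 𝟙[ C w ∧ plus I u w ])) (sumℕ-cong degFrom)
    where
    degFrom : ∀ w → count (λ u → C w ∧ plus I u w) ≡ (if C w then deg I w else 0)
    degFrom w with C w
    ... | true  = count-cong (λ u → plus-sym I u w)
    ... | false = sumℕ-zero n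

  plusCut≡sum-outside : ∀ C → plusCut I C ≡ sumℕ (λ u → if C u then 0 else degTo I u C)
  plusCut≡sum-outside C = trans (sumℕ-comm (λ u w → 𝟙[ C u ∧ not (C w) ∧ plus I u w ])) (sumℕ-cong cutAt)
    where
    cutAt : ∀ w → count (λ u → C u ∧ not (C w) ∧ plus I u w) ≡ (if C w then 0 else degTo I w C)
    cutAt w with C w
    ... | true  = count-false (λ u → ∧-zeroʳ (C u))
    ... | false = count-cong (λ u → cong (C u ∧_) (plus-sym I u w))

  twice-cost : ∀ C → toℚ 2 * cost I C ≡ toℚ (plusCut I C ℕ.+ 2 ℕ.* minusIn I C)
  twice-cost C = begin
    toℚ 2 * (½ * toℚ pc + toℚ mi)  ≡⟨ solve 2 (λ p m → con (toℚ 2) :* (con ½ :* p :+ m) := p :+ con (toℚ 2) :* m)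
                                               refl (toℚ pc) (toℚ mi) ⟩
    toℚ pc + toℚ 2 * toℚ mi        ≡⟨ cong (toℚ pc +_) (toℚ-* 2 mi) ⟨
    toℚ pc + toℚ (2 ℕ.* mi)        ≡⟨ toℚ-+ pc (2 ℕ.* mi) ⟨
    toℚ (pc ℕ.+ 2 ℕ.* mi)          ∎
    where
    open ≡-Reasoning
    ½  = ℤ.+ 1 / 2
    pc = plusCut I C
    mi = minusIn I C

  plusCut≤twice-cost : ∀ C → toℚ (plusCut I C) ≤ toℚ 2 * cost I C
  plusCut≤twice-cost C = subst (toℚ (plusCut I C) ≤_) (sym (twice-cost C))
    (toℚ-mono-≤ (ℕ.m≤m+n (plusCut I C) (2 ℕ.* minusIn I C)))

module _ {n} {I : Instance n} (P : Preclustering I) where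
  open Preclustering P

  atomSet⇒atom : ∀ {i v} → atomSet I P i v ≡ true → atom v ≡ just i
  atomSet⇒atom {i} {v} v∈i with atom v
  atomSet⇒atom {i} {v} v∈i | just j = cong just (≡ᵇ⇒≡ v∈i)
  atomSet⇒atom {i} {v} ()  | nothing

  adm⇒∉atom : ∀ {i u v} → adm u v ≡ true → atomSet I P i v ≡ true → atomSet I P i u ≡ false
  adm⇒∉atom {i} {u} {v} uv∈adm v∈i with adm-out u v uv∈adm
  ... | inj₁ u-singleton = cong (λ m → isAtom m i) u-singleton
  ... | inj₂ v-singleton with () ← trans (sym (atomSet⇒atom v∈i)) v-singleton

  dCross-atom : ∀ {v j} → atom v ≡ just j →
                dCross I P v ≡ toℚ 2 * cost I (atomSet I P j) * invℕ (size I (atomSet I P j))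
  dCross-atom {v} v∈j with atom v
  dCross-atom refl | .(just _) = refl

  dCross-singleton : ∀ {v} → atom v ≡ nothing → dCross I P v ≡ toℚ (deg I v) - 1ℚ
  dCross-singleton {v} v-singleton with atom v
  dCross-singleton refl | .nothing = refl

  K-atom : ∀ {u j} w → atom u ≡ just j → K I P u w ≡ atomSet I P j w
  K-atom {u} w u∈j with atom u
  K-atom w refl | .(just _) = refl

  K-singleton : ∀ {u} w → atom u ≡ nothing → K I P u w ≡ (w ≡ᵇ u)
  K-singleton {u} w u-singleton with atom u
  K-singleton w refl | .nothing = refl

  dCrossSet-atom : ∀ i → dCrossSet I P (atomSet I P i) ≡ toℚ 2 * cost I (atomSet I P i)
  dCrossSet-atom i = begin
    sumℚ (λ v → whenℚ (atomSet I P i v) (dCross I P v))  ≡⟨ sumℚ-cong dCross-on-atom ⟩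
    sumℚ (λ v → whenℚ (atomSet I P i v) (c * invℕ s))    ≡⟨ sumℚ-whenℚ (atomSet I P i) (c * invℕ s) ⟩
    toℚ s * (c * invℕ s)                                  ≡⟨ *-invℕ-cancelˡ c (ℕ.≤-trans (ℕ.s≤s z≤n) (atom-big i)) ⟩
    c                                                     ∎
    where
    open ≡-Reasoning
    c = toℚ 2 * cost I (atomSet I P i)
    s = size I (atomSet I P i)
    dCross-on-atom : ∀ v → whenℚ (atomSet I P i v) (dCross I P v) ≡ whenℚ (atomSet I P i v) (c * invℕ s)
    dCross-on-atom v with atomSet I P i v in v∈i
    ... | true  = dCross-atom (atomSet⇒atom v∈i)
    ... | false = refl

-- The admissible degree of an atom

module AdmissibleDegreeOfAtom {n} {I : Instance n} (P : Preclustering I) (i : Fin (Preclustering.k P))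
  (c₀ ε : ℚ) (0≤ε : 0ℚ ≤ ε) (ε≤1 : ε ≤ 1ℚ) (0≤c₀ε : 0ℚ ≤ c₀ * ε) (2c₀ε≤1 : toℚ 2 * (c₀ * ε) ≤ 1ℚ)
  (simB : SimB I P ε) (simC : SimC I P c₀ ε) where
  open Preclustering P

  S : Subset n
  S = atomSet I P i

  s : ℕ
  s = size I S

  d : Fin n → ℚ
  d v = toℚ (deg I v)

  size≤2deg : ∀ {v} → S v ≡ true → toℚ s ≤ toℚ 2 * d v
  size≤2deg {v} v∈S = begin
    toℚ s                                      ≤⟨ ≤-+-nonNeg (*-nonNeg (p≤q⇒0≤q-p 2c₀ε≤1) (toℚ-nonNeg s)) ⟩
    toℚ s + (1ℚ - toℚ 2 * (c₀ * ε)) * toℚ s    ≡⟨ solve 2 (λ s a → s :+ (con 1ℚ :- con (toℚ 2) :* a) :* s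
                                                           := con (toℚ 2) :* ((con 1ℚ :- a) :* s)) refl (toℚ s) (c₀ * ε) ⟩
    toℚ 2 * ((1ℚ - c₀ * ε) * toℚ s)            ≤⟨ *-monoˡ-≤-nonNeg′ (toℚ-nonNeg 2) (proj₁ (simC i v v∈S)) ⟩
    toℚ 2 * toℚ (degTo I v S)                  ≤⟨ *-monoˡ-≤-nonNeg′ (toℚ-nonNeg 2) (toℚ-mono-≤ (degTo≤deg I v S)) ⟩
    toℚ 2 * d v                                ∎
    where open ≤-Reasoning

  deg≤2size : ∀ {v} → S v ≡ true → d v ≤ toℚ 2 * toℚ s
  deg≤2size {v} v∈S = begin
    d v                                               ≡⟨ cong toℚ (deg≡degTo+degToᶜ I v S) ⟩
    toℚ (degTo I v S ℕ.+ degTo I v (not ∘ S))         ≡⟨ toℚ-+ (degTo I v S) (degTo I v (not ∘ S)) ⟩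
    toℚ (degTo I v S) + toℚ (degTo I v (not ∘ S))     ≤⟨ +-mono-≤ (toℚ-mono-≤ (degTo≤size I v S)) (proj₂ (simC i v v∈S)) ⟩
    toℚ s + c₀ * ε * toℚ s                            ≤⟨ +-monoʳ-≤ (toℚ s) (*-≤-of-≤1 (toℚ-nonNeg s) c₀ε≤1) ⟩
    toℚ s + toℚ s                                     ≡⟨ solve 1 (λ s → s :+ s := con (toℚ 2) :* s) refl (toℚ s) ⟩
    toℚ 2 * toℚ s                                     ∎
    where
    open ≤-Reasoning
    c₀ε≤1 : c₀ * ε ≤ 1ℚ
    c₀ε≤1 = ≤-trans (≤-+-nonNeg 0≤c₀ε)
              (≤-trans (≤-reflexive (solve 1 (λ a → a :+ a := con (toℚ 2) :* a) refl (c₀ * ε))) 2c₀ε≤1)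

  simNbrOutside : Fin n → Subset n
  simNbrOutside v w = not (S w) ∧ plus I v w ∧ degSim I ε w v

  commonSimNbrs : Fin n → Fin n → Subset n
  commonSimNbrs v u w = plus I v w ∧ plus I u w ∧ degSim I ε w v ∧ degSim I ε w u

  commonSimNbrs≤ : ∀ v u → count (commonSimNbrs v u) ℕ.≤ degTo I u (simNbrOutside v) ℕ.+ degTo I u S
  commonSimNbrs≤ v u = count-≤-+ {q = λ w → simNbrOutside v w ∧ plus I u w} {r = λ w → S w ∧ plus I u w}
    (λ w → inside-or-outside (S w) (plus I v w) (plus I u w) (degSim I ε w v) (degSim I ε w u))
    where
    inside-or-outside : ∀ σ a b c e → T (a ∧ b ∧ c ∧ e) → T ((not σ ∧ a ∧ c) ∧ b) ⊎ T (σ ∧ b)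
    inside-or-outside true  true true _    _ _ = inj₂ tt
    inside-or-outside false true true true _ _ = inj₁ tt

  admissible-neighbour-bound : ∀ {v u} → S v ≡ true → adm v u ≡ true →
                               ε * ε * toℚ s ≤ toℚ 4 * toℚ (degTo I u (simNbrOutside v) ℕ.+ degTo I u S)
  admissible-neighbour-bound {v} {u} v∈S vu∈adm = begin
    ε * ε * toℚ s                                ≡⟨ *-assoc ε ε (toℚ s) ⟩
    ε * (ε * toℚ s)                              ≤⟨ *-monoˡ-≤-nonNeg′ 0≤ε (ε*s≤4*[a⊓b] 0≤ε ε≤1 (toℚ-nonNeg s)
                                                      (toℚ-nonNeg (deg I v)) (size≤2deg v∈S) (proj₁ (simB v u vu∈adm))) ⟩
    ε * (toℚ 4 * (d v ⊓ d u))                    ≡⟨ ℚ*.x∙yz≈y∙xz ε (toℚ 4) (d v ⊓ d u) ⟩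
    toℚ 4 * (ε * (d v ⊓ d u))                    ≤⟨ *-monoˡ-≤-nonNeg′ (toℚ-nonNeg 4) (proj₂ (simB v u vu∈adm)) ⟩
    toℚ 4 * toℚ (count (commonSimNbrs v u))      ≤⟨ *-monoˡ-≤-nonNeg′ (toℚ-nonNeg 4) (toℚ-mono-≤ (commonSimNbrs≤ v u)) ⟩
    toℚ 4 * toℚ (degTo I u (simNbrOutside v) ℕ.+ degTo I u S) ∎
    where open ≤-Reasoning

  simNbrDegSum : Fin n → ℕ
  simNbrDegSum v = sumℕ (λ w → if simNbrOutside v w then deg I w else 0)

  dAdm-ε²-bound : ∀ {v} → S v ≡ true →
                  toℚ (dAdm I P v) * (ε * ε * toℚ s) ≤ toℚ (simNbrDegSum v ℕ.+ plusCut I S) * toℚ 4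
  dAdm-ε²-bound {v} v∈S = subst (λ m → toℚ (dAdm I P v) * (ε * ε * toℚ s) ≤ toℚ m * toℚ 4) sum-rhs
    (sumℕ-scaled-≤ (λ u → 𝟙[ adm u v ]) rhs per-neighbour)
    where
    rhs : Fin n → ℕ
    rhs u = degTo I u (simNbrOutside v) ℕ.+ (if S u then 0 else degTo I u S)
    sum-rhs : sumℕ rhs ≡ simNbrDegSum v ℕ.+ plusCut I S
    sum-rhs = trans (sumℕ-+ (λ u → degTo I u (simNbrOutside v)) (λ u → if S u then 0 else degTo I u S))
                    (cong₂ ℕ._+_ (sum-degTo I (simNbrOutside v)) (sym (plusCut≡sum-outside I S)))
    per-neighbour : ∀ u → toℚ 𝟙[ adm u v ] * (ε * ε * toℚ s) ≤ toℚ (rhs u) * toℚ 4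
    per-neighbour u = toℚ-if-*-≤ (adm u v) 1 (*-nonNeg (toℚ-nonNeg (rhs u)) (toℚ-nonNeg 4)) λ uv∈adm → begin
      1ℚ * (ε * ε * toℚ s)                       ≡⟨ *-identityˡ (ε * ε * toℚ s) ⟩
      ε * ε * toℚ s                              ≤⟨ admissible-neighbour-bound v∈S (trans (adm-sym v u) uv∈adm) ⟩
      toℚ 4 * toℚ (simDeg ℕ.+ degTo I u S)       ≡⟨ *-comm (toℚ 4) (toℚ (simDeg ℕ.+ degTo I u S)) ⟩
      toℚ (simDeg ℕ.+ degTo I u S) * toℚ 4       ≡⟨ cong (λ b → toℚ (simDeg ℕ.+ (if b then 0 else degTo I u S)) * toℚ 4)
                                                         (adm⇒∉atom P uv∈adm v∈S) ⟨
      toℚ (rhs u) * toℚ 4                        ∎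
      where
      open ≤-Reasoning
      simDeg = degTo I u (simNbrOutside v)

  simNbrDegSum-bound : ∀ v → toℚ (simNbrDegSum v) * ε ≤ toℚ (degTo I v (not ∘ S)) * d v
  simNbrDegSum-bound v = sumℕ-scaled-≤ (λ w → if simNbrOutside v w then deg I w else 0)
    (λ w → 𝟙[ not (S w) ∧ plus I v w ])
    (λ w → bound-at w (not (S w)) (plus I v w) (degSim I ε w v) (degSim⇒ w))
    where
    degSim⇒ : ∀ w → T (degSim I ε w v) → ε * d w ≤ d v
    degSim⇒ w = ≤ᵇ⇒≤ ∘ proj₁ ∘ Equivalence.to T-∧
    bound-at : ∀ w a b c → (T c → ε * d w ≤ d v) →
               toℚ (if a ∧ b ∧ c then deg I w else 0) * ε ≤ toℚ 𝟙[ a ∧ b ] * d v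
    bound-at w false _     _     _ = ≤-reflexive (trans (*-zeroˡ ε) (sym (*-zeroˡ (d v))))
    bound-at w true  false _     _ = ≤-reflexive (trans (*-zeroˡ ε) (sym (*-zeroˡ (d v))))
    bound-at w true  true  false _ = subst (_≤ 1ℚ * d v) (sym (*-zeroˡ ε)) (*-nonNeg (toℚ-nonNeg 1) (toℚ-nonNeg (deg I v)))
    bound-at w true  true  true  εdw≤dv = begin
      d w * ε      ≡⟨ *-comm (d w) ε ⟩
      ε * d w      ≤⟨ εdw≤dv _ ⟩
      d v          ≡⟨ *-identityˡ (d v) ⟨
      1ℚ * d v     ∎
      where open ≤-Reasoning

  outDeg : Fin n → ℕ
  outDeg v = count (λ w → S v ∧ not (S w) ∧ plus I v w)

  dAdm-cubic-bound : ∀ {v} → S v ≡ true →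
                     toℚ (dAdm I P v) * (pow ε 3 * toℚ s) ≤ toℚ (8 ℕ.* s ℕ.* degTo I v (not ∘ S) ℕ.+ 4 ℕ.* plusCut I S)
  dAdm-cubic-bound {v} v∈S = begin
    D * (pow ε 3 * toℚ s)                             ≡⟨ solve 3 (λ D ε s → D :* (ε :* (ε :* (ε :* con 1ℚ)) :* s)
                                                                  := ε :* (D :* (ε :* ε :* s))) refl D ε (toℚ s) ⟩
    ε * (D * (ε * ε * toℚ s))                         ≤⟨ *-monoˡ-≤-nonNeg′ 0≤ε (dAdm-ε²-bound v∈S) ⟩
    ε * (toℚ (simNbrDegSum v ℕ.+ pc) * toℚ 4)         ≡⟨ cong (λ q → ε * (q * toℚ 4)) (toℚ-+ (simNbrDegSum v) pc) ⟩
    ε * ((toℚ (simNbrDegSum v) + toℚ pc) * toℚ 4)     ≡⟨ solve 3 (λ ε σ p → ε :* ((σ :+ p) :* con (toℚ 4))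
                                                                  := con (toℚ 4) :* (σ :* ε) :+ con (toℚ 4) :* (ε :* p))
                                                              refl ε (toℚ (simNbrDegSum v)) (toℚ pc) ⟩
    toℚ 4 * (toℚ (simNbrDegSum v) * ε) + toℚ 4 * (ε * toℚ pc)
      ≤⟨ +-mono-≤ (*-monoˡ-≤-nonNeg′ (toℚ-nonNeg 4) (simNbrDegSum-bound v))
                  (*-monoˡ-≤-nonNeg′ (toℚ-nonNeg 4) (*-≤-of-≤1 (toℚ-nonNeg pc) ε≤1)) ⟩
    toℚ 4 * (toℚ out * d v) + toℚ 4 * toℚ pc
      ≤⟨ +-monoˡ-≤ (toℚ 4 * toℚ pc) (*-monoˡ-≤-nonNeg′ (toℚ-nonNeg 4) (*-monoˡ-≤-nonNeg′ (toℚ-nonNeg out) (deg≤2size v∈S))) ⟩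
    toℚ 4 * (toℚ out * (toℚ 2 * toℚ s)) + toℚ 4 * toℚ pc
      ≡⟨ solve 3 (λ o s p → con (toℚ 4) :* (o :* (con (toℚ 2) :* s)) :+ con (toℚ 4) :* p
                          := con (toℚ 8) :* s :* o :+ con (toℚ 4) :* p) refl (toℚ out) (toℚ s) (toℚ pc) ⟩
    toℚ 8 * toℚ s * toℚ out + toℚ 4 * toℚ pc
      ≡⟨ cong (λ x → x * toℚ out + toℚ 4 * toℚ pc) (toℚ-* 8 s) ⟨
    toℚ (8 ℕ.* s) * toℚ out + toℚ 4 * toℚ pc
      ≡⟨ toℚ-*-+-* (8 ℕ.* s) out 4 pc ⟨
    toℚ (8 ℕ.* s ℕ.* out ℕ.+ 4 ℕ.* pc) ∎
    where
    open ≤-Reasoning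
    D   = toℚ (dAdm I P v)
    pc  = plusCut I S
    out = degTo I v (not ∘ S)

  vertexCharge : Fin n → ℕ
  vertexCharge v = 8 ℕ.* s ℕ.* outDeg v ℕ.+ 4 ℕ.* plusCut I S ℕ.* 𝟙[ S v ]

  weighted-dAdm-bound : ∀ v → toℚ (if S v then dAdm I P v else 0) * (pow ε 3 * toℚ s) ≤ toℚ (vertexCharge v)
  weighted-dAdm-bound v = toℚ-if-*-≤ (S v) (dAdm I P v) (toℚ-nonNeg (vertexCharge v)) λ v∈S →
    subst (λ m → toℚ (dAdm I P v) * (pow ε 3 * toℚ s) ≤ toℚ m) (sym (vertexCharge-in-atom v∈S)) (dAdm-cubic-bound v∈S)
    where
    vertexCharge-in-atom : S v ≡ true → vertexCharge v ≡ 8 ℕ.* s ℕ.* degTo I v (not ∘ S) ℕ.+ 4 ℕ.* plusCut I S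
    vertexCharge-in-atom v∈S =
      trans (cong (λ b → 8 ℕ.* s ℕ.* count (λ w → b ∧ not (S w) ∧ plus I v w) ℕ.+ 4 ℕ.* plusCut I S ℕ.* 𝟙[ b ]) v∈S)
            (cong (8 ℕ.* s ℕ.* degTo I v (not ∘ S) ℕ.+_) (ℕ.*-identityʳ (4 ℕ.* plusCut I S)))

  sum-vertexCharge : sumℕ vertexCharge ≡ 12 ℕ.* plusCut I S ℕ.* s
  sum-vertexCharge = begin
    sumℕ vertexCharge
      ≡⟨ sumℕ-+ (λ v → 8 ℕ.* s ℕ.* outDeg v) (λ v → 4 ℕ.* pc ℕ.* 𝟙[ S v ]) ⟩
    sumℕ (λ v → 8 ℕ.* s ℕ.* outDeg v) ℕ.+ sumℕ (λ v → 4 ℕ.* pc ℕ.* 𝟙[ S v ])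
      ≡⟨ cong₂ ℕ._+_ (sumℕ-*ˡ (8 ℕ.* s) outDeg) (sumℕ-*ˡ (4 ℕ.* pc) (𝟙[_] ∘ S)) ⟩
    8 ℕ.* s ℕ.* pc ℕ.+ 4 ℕ.* pc ℕ.* s
      ≡⟨ 8sp+4ps≡12ps s pc ⟩
    12 ℕ.* pc ℕ.* s ∎
    where
    open ≡-Reasoning
    pc = plusCut I S
    8sp+4ps≡12ps : ∀ s p → 8 ℕ.* s ℕ.* p ℕ.+ 4 ℕ.* p ℕ.* s ≡ 12 ℕ.* p ℕ.* s
    8sp+4ps≡12ps = solve-∀

  dAdmSet-bound : pow ε 3 * toℚ (dAdmSet I P S) ≤ toℚ 12 * toℚ (plusCut I S)
  dAdmSet-bound = *-cancelʳ-≤-pos (toℚ s) {{positive 0<s}} (begin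
    pow ε 3 * toℚ (dAdmSet I P S) * toℚ s    ≡⟨ ℚ*.xy∙z≈y∙xz (pow ε 3) (toℚ (dAdmSet I P S)) (toℚ s) ⟩
    toℚ (dAdmSet I P S) * (pow ε 3 * toℚ s)  ≤⟨ sumℕ-scaled-≤′ (λ v → if S v then dAdm I P v else 0) vertexCharge
                                                                weighted-dAdm-bound ⟩
    toℚ (sumℕ vertexCharge)                  ≡⟨ cong toℚ sum-vertexCharge ⟩
    toℚ (12 ℕ.* plusCut I S ℕ.* s)           ≡⟨ trans (toℚ-* (12 ℕ.* plusCut I S) s)
                                                      (cong (_* toℚ s) (toℚ-* 12 (plusCut I S))) ⟩
    toℚ 12 * toℚ (plusCut I S) * toℚ s       ∎)
    where
    open ≤-Reasoning
    0<s : toℚ s > 0ℚ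
    0<s = <-≤-trans (positive⁻¹ (toℚ 2)) (toℚ-mono-≤ (atom-big i))

  dAdmSet≤twice-cost : ℤ.+ 1 / 12 * pow ε 3 * toℚ (dAdmSet I P S) ≤ toℚ 2 * cost I S
  dAdmSet≤twice-cost = begin
    ℤ.+ 1 / 12 * pow ε 3 * toℚ (dAdmSet I P S)    ≡⟨ *-assoc (ℤ.+ 1 / 12) (pow ε 3) (toℚ (dAdmSet I P S)) ⟩
    ℤ.+ 1 / 12 * (pow ε 3 * toℚ (dAdmSet I P S))  ≤⟨ *-monoˡ-≤-nonNeg′ (<⇒≤ (positive⁻¹ (ℤ.+ 1 / 12))) dAdmSet-bound ⟩
    ℤ.+ 1 / 12 * (toℚ 12 * toℚ (plusCut I S))     ≡⟨ solve 1 (λ p → con (ℤ.+ 1 / 12) :* (con (toℚ 12) :* p) := p)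
                                                           refl (toℚ (plusCut I S)) ⟩
    toℚ (plusCut I S)                             ≤⟨ plusCut≤twice-cost I S ⟩
    toℚ 2 * cost I S                              ∎
    where open ≤-Reasoning

-- Charging the crossing degree to disagreements and admissible pairs

module _ {n} {I : Instance n} (P : Preclustering I) where
  open Preclustering P

  singletonPair : Fin n → Fin n → ℕ
  singletonPair v w = 𝟙[ is-nothing (atom v) ∧ not (v ≡ᵇ w) ∧ plus I v w ]

  atomCost : Fin k → ℕ
  atomCost i = plusCut I (atomSet I P i) ℕ.+ 2 ℕ.* minusIn I (atomSet I P i)

  dCross-split : ∀ v → dCross I P v ≡ whenℚ (is-nothing (atom v)) (dCross I P v)
                                       + sumℚ (λ i → whenℚ (atomSet I P i v) (dCross I P v))
  dCross-split v = split (atom v) (dCross I P v)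
    where
    split : ∀ m q → q ≡ whenℚ (is-nothing m) q + sumℚ (λ i → whenℚ (isAtom m i) q)
    split nothing  q = sym (trans (cong (q +_) (sumℚ-zero k)) (+-identityʳ q))
    split (just j) q = sym (begin
      0ℚ + sumℚ (λ i → whenℚ (j ≡ᵇ i) q)   ≡⟨ +-identityˡ _ ⟩
      sumℚ (λ i → whenℚ (j ≡ᵇ i) q)        ≡⟨ sumℚ-whenℚ (j ≡ᵇ_) q ⟩
      toℚ (count (j ≡ᵇ_)) * q              ≡⟨ cong (λ c → toℚ c * q) (count-≡ᵇ j) ⟩
      1ℚ * q                               ≡⟨ *-identityˡ q ⟩
      q                                    ∎)
      where open ≡-Reasoning

  singleton-dCross≤ : ∀ v → whenℚ (is-nothing (atom v)) (dCross I P v) ≤ toℚ (sumℕ (singletonPair v))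
  singleton-dCross≤ v = bound (atom v) refl
    where
    pairs : Maybe (Fin k) → ℕ
    pairs m = sumℕ (λ w → 𝟙[ is-nothing m ∧ not (v ≡ᵇ w) ∧ plus I v w ])
    bound : ∀ m → atom v ≡ m → whenℚ (is-nothing m) (dCross I P v) ≤ toℚ (pairs m)
    bound (just j) _           = toℚ-nonNeg (pairs (just j))
    bound nothing  v-singleton = subst (_≤ toℚ (pairs nothing)) (sym (dCross-singleton P v-singleton))
      (≤-+⇒-≤ {p = toℚ (deg I v)} {r = 1ℚ} (begin
        toℚ (deg I v)                   ≤⟨ toℚ-mono-≤ deg≤1+others ⟩
        toℚ (1 ℕ.+ pairs nothing)       ≡⟨ toℚ-+ 1 (pairs nothing) ⟩
        1ℚ + toℚ (pairs nothing)        ∎))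
      where
      open ≤-Reasoning
      deg≤1+others : deg I v ℕ.≤ 1 ℕ.+ pairs nothing
      deg≤1+others = subst (ℕ._≤ 1 ℕ.+ pairs nothing) (sym (count-split (v ≡ᵇ_) (plus I v)))
        (ℕ.+-monoˡ-≤ (pairs nothing) (subst (count (λ w → (v ≡ᵇ w) ∧ plus I v w) ℕ.≤_) (count-≡ᵇ v)
          (count-mono-≤ {q = v ≡ᵇ_} (λ w → proj₁ ∘ Equivalence.to (T-∧ {v ≡ᵇ w})))))

  totalCharge : ℕ
  totalCharge = sumℕ² singletonPair ℕ.+ sumℕ atomCost

  dCrossSet-all≤totalCharge : dCrossSet I P (λ _ → true) ≤ toℚ totalCharge
  dCrossSet-all≤totalCharge = begin
    sumℚ (dCross I P)
      ≡⟨ sumℚ-cong dCross-split ⟩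
    sumℚ (λ v → single v + sumℚ (λ i → whenℚ (atomSet I P i v) (dCross I P v)))
      ≡⟨ sumℚ-+ single (λ v → sumℚ (λ i → whenℚ (atomSet I P i v) (dCross I P v))) ⟩
    sumℚ single + sumℚ (λ v → sumℚ (λ i → whenℚ (atomSet I P i v) (dCross I P v)))
      ≡⟨ cong (sumℚ single +_) (sumℚ-comm (λ v i → whenℚ (atomSet I P i v) (dCross I P v))) ⟩
    sumℚ single + sumℚ (λ i → dCrossSet I P (atomSet I P i))
      ≡⟨ cong (sumℚ single +_) (sumℚ-cong (λ i → trans (dCrossSet-atom P i) (twice-cost I (atomSet I P i)))) ⟩
    sumℚ single + sumℚ (toℚ ∘ atomCost)
      ≤⟨ +-monoˡ-≤ (sumℚ (toℚ ∘ atomCost)) (sumℚ-mono-≤ singleton-dCross≤) ⟩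
    sumℚ (λ v → toℚ (sumℕ (singletonPair v))) + sumℚ (toℚ ∘ atomCost)
      ≡⟨ cong₂ _+_ (toℚ-sumℕ (λ v → sumℕ (singletonPair v))) (toℚ-sumℕ atomCost) ⟨
    toℚ (sumℕ² singletonPair) + toℚ (sumℕ atomCost)
      ≡⟨ toℚ-+ (sumℕ² singletonPair) (sumℕ atomCost) ⟨
    toℚ (sumℕ² singletonPair ℕ.+ sumℕ atomCost) ∎
    where
    open ≤-Reasoning
    single : Fin n → ℚ
    single v = whenℚ (is-nothing (atom v)) (dCross I P v)

  atomPair : Fin k → Fin n → Fin n → ℕ
  atomPair i u w = 𝟙[ atomSet I P i u ∧ not (atomSet I P i w) ∧ plus I u w ]
                   ℕ.+ 2 ℕ.* 𝟙[ (u <V w) ∧ atomSet I P i u ∧ atomSet I P i w ∧ not (plus I u w) ]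

  sum-atomPair : ∀ i → sumℕ² (atomPair i) ≡ atomCost i
  sum-atomPair i = trans (sumℕ²-+ cut (λ u w → 2 ℕ.* 𝟙[ (u <V w) ∧ atomSet I P i u ∧ atomSet I P i w ∧ not (plus I u w) ]))
    (cong (sumℕ² cut ℕ.+_) (sumℕ²-*ˡ 2 (λ u w → 𝟙[ (u <V w) ∧ atomSet I P i u ∧ atomSet I P i w ∧ not (plus I u w) ])))
    where
    cut : Fin n → Fin n → ℕ
    cut u w = 𝟙[ atomSet I P i u ∧ not (atomSet I P i w) ∧ plus I u w ]

  charge : Maybe (Fin k) → Fin n → Fin n → ℕ
  charge nothing  u w = 𝟙[ not (u ≡ᵇ w) ∧ plus I u w ]
  charge (just j) u w = 𝟙[ not (atomSet I P j w) ∧ plus I u w ]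
                        ℕ.+ 2 ℕ.* 𝟙[ (u <V w) ∧ atomSet I P j w ∧ not (plus I u w) ]

  singletonPair+atomPairs≡charge : ∀ u w → singletonPair u w ℕ.+ sumℕ (λ i → atomPair i u w) ≡ charge (atom u) u w
  singletonPair+atomPairs≡charge u w = by-atom (atom u)
    where
    by-atom : ∀ m → 𝟙[ is-nothing m ∧ not (u ≡ᵇ w) ∧ plus I u w ]
                    ℕ.+ sumℕ (λ i → 𝟙[ isAtom m i ∧ not (atomSet I P i w) ∧ plus I u w ]
                                    ℕ.+ 2 ℕ.* 𝟙[ (u <V w) ∧ isAtom m i ∧ atomSet I P i w ∧ not (plus I u w) ])
                    ≡ charge m u w
    by-atom nothing = trans (cong (𝟙[ not (u ≡ᵇ w) ∧ plus I u w ] ℕ.+_)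
        (trans (sumℕ-cong {k} {g = λ _ → 0} (λ i → cong (λ b → 2 ℕ.* 𝟙[ b ]) (∧-zeroʳ (u <V w)))) (sumℕ-zero k)))
      (ℕ.+-identityʳ _)
    by-atom (just j) = trans (sumℕ-cong (λ i → only-at (j ≡ᵇ i) (u <V w))) (sumℕ-≡ᵇ j _)
      where
      only-at : ∀ b l {x y} → 𝟙[ b ∧ x ] ℕ.+ 2 ℕ.* 𝟙[ l ∧ b ∧ y ] ≡ (if b then 𝟙[ x ] ℕ.+ 2 ℕ.* 𝟙[ l ∧ y ] else 0)
      only-at true  l     = refl
      only-at false true  = refl
      only-at false false = refl

module ClusteringCharge {n} {I : Instance n} (P : Preclustering I) (cl : Clustering I)
  (atoms-unbroken : ∀ u w → atomic I P u w ≡ true → cl u ≡ cl w)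
  (clusters-admissible : ∀ u w → cl u ≡ cl w → atomic I P u w ≡ true ⊎ Preclustering.adm P u w ≡ true) where
  open Preclustering P

  disagrees : Fin n → Fin n → Bool
  disagrees u w = (u <V w) ∧ ((plus I u w ∧ not (cl u ≡ᵇ cl w)) ∨ (not (plus I u w) ∧ (cl u ≡ᵇ cl w)))

  admissiblePair : Fin n → Fin n → Bool
  admissiblePair u w = (u <V w ∨ u ≡ᵇ w) ∧ adm u w

  χcost χadm : Fin n → Fin n → ℕ
  χcost u w = 𝟙[ disagrees u w ] ℕ.+ 𝟙[ disagrees w u ]
  χadm  u w = 𝟙[ admissiblePair u w ] ℕ.+ 𝟙[ admissiblePair w u ]

  disagrees-cut : ∀ {u w} → (u <V w) ≡ true → plus I u w ≡ true → cl u ≢ cl w → disagrees u w ≡ true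
  disagrees-cut {u} {w} u<w uw∈E⁺ separated = cut u<w uw∈E⁺ (dec-false (cl u Fin.≟ cl w) separated)
    where
    cut : ∀ {l p c} → l ≡ true → p ≡ true → c ≡ false → l ∧ ((p ∧ not c) ∨ (not p ∧ c)) ≡ true
    cut refl refl refl = refl

  disagrees-join : ∀ {u w} → (u <V w) ≡ true → plus I u w ≡ false → cl u ≡ cl w → disagrees u w ≡ true
  disagrees-join {u} {w} u<w uw∈E⁻ joined = join u<w uw∈E⁻ (dec-true (cl u Fin.≟ cl w) joined)
    where
    join : ∀ {l p c} → l ≡ true → p ≡ false → c ≡ true → l ∧ ((p ∧ not c) ∨ (not p ∧ c)) ≡ true
    join refl refl refl = refl

  1≤𝟙+ : ∀ {b} m → b ≡ true → 1 ℕ.≤ 𝟙[ b ] ℕ.+ m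
  1≤𝟙+ m refl = ℕ.s≤s z≤n

  1≤+𝟙 : ∀ {b} m → b ≡ true → 1 ℕ.≤ m ℕ.+ 𝟙[ b ]
  1≤+𝟙 m refl = ℕ.m≤n+m 1 m

  cut-charged : ∀ {u w} → u ≢ w → cl u ≢ cl w → plus I u w ≡ true → 1 ℕ.≤ χcost u w
  cut-charged {u} {w} u≢w separated uw∈E⁺ with ≢⇒<V u≢w
  ... | inj₁ u<w = 1≤𝟙+ _ (disagrees-cut u<w uw∈E⁺ separated)
  ... | inj₂ w<u = 1≤+𝟙 _ (disagrees-cut w<u (trans (plus-sym I w u) uw∈E⁺) (separated ∘ sym))

  admissible-charged : ∀ {u w} → u ≢ w → adm u w ≡ true → 1 ℕ.≤ χadm u w
  admissible-charged {u} {w} u≢w uw∈adm with ≢⇒<V u≢w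
  ... | inj₁ u<w = 1≤𝟙+ _ (trans (cong (λ l → (l ∨ (u ≡ᵇ w)) ∧ adm u w) u<w) uw∈adm)
  ... | inj₂ w<u = 1≤+𝟙 _ (trans (cong (λ l → (l ∨ (w ≡ᵇ u)) ∧ adm w u) w<u) (trans (adm-sym w u) uw∈adm))

  plusEdge-charged : ∀ {u w} → u ≢ w → atomic I P u w ≡ false → plus I u w ≡ true → 1 ℕ.≤ χcost u w ℕ.+ χadm u w
  plusEdge-charged {u} {w} u≢w non-atomic uw∈E⁺ = by-cluster (cl u Fin.≟ cl w)
    where
    by-cluster : Dec (cl u ≡ cl w) → 1 ℕ.≤ χcost u w ℕ.+ χadm u w
    by-cluster (no separated) = ℕ.≤-trans (cut-charged u≢w separated uw∈E⁺) (ℕ.m≤m+n (χcost u w) (χadm u w))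
    by-cluster (yes joined) with clusters-admissible u w joined
    ... | inj₁ atomic-uw with () ← trans (sym non-atomic) atomic-uw
    ... | inj₂ uw∈adm = ℕ.≤-trans (admissible-charged u≢w uw∈adm) (ℕ.m≤n+m (χadm u w) (χcost u w))

  minusEdge-charged : ∀ {u w} → (u <V w) ≡ true → atomic I P u w ≡ true → plus I u w ≡ false → 1 ℕ.≤ χcost u w
  minusEdge-charged {u} {w} u<w atomic-uw uw∈E⁻ = 1≤𝟙+ _ (disagrees-join u<w uw∈E⁻ (atoms-unbroken u w atomic-uw))

  charge-bound : ∀ u w → charge P (atom u) u w ℕ.≤ 3 ℕ.* χcost u w ℕ.+ χadm u w
  charge-bound u w = by-atom (atom u) refl
    where
    X+Y≤3X+Y : χcost u w ℕ.+ χadm u w ℕ.≤ 3 ℕ.* χcost u w ℕ.+ χadm u w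
    X+Y≤3X+Y = ℕ.+-monoˡ-≤ (χadm u w) (ℕ.m≤n*m (χcost u w) 3)
    by-atom : ∀ m → atom u ≡ m → charge P m u w ℕ.≤ 3 ℕ.* χcost u w ℕ.+ χadm u w
    by-atom nothing u-singleton = 𝟙-≤ (not (u ≡ᵇ w) ∧ plus I u w) λ h →
      let u≢w = ≡ᵇ-false⇒≢ (not-injective (∧-conicalˡ _ _ h))
      in ℕ.≤-trans (plusEdge-charged u≢w (trans (K-singleton P w u-singleton) (dec-false (w Fin.≟ u) (u≢w ∘ sym)))
                                      (∧-conicalʳ _ _ h))
                   X+Y≤3X+Y
    by-atom (just j) u∈j = ℕ.≤-trans (ℕ.+-mono-≤ cut-bound (ℕ.*-monoʳ-≤ 2 inner-bound))
                                     (ℕ.≤-reflexive (X+Y+2X≡3X+Y (χcost u w) (χadm u w)))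
      where
      X+Y+2X≡3X+Y : ∀ x y → x ℕ.+ y ℕ.+ 2 ℕ.* x ≡ 3 ℕ.* x ℕ.+ y
      X+Y+2X≡3X+Y = solve-∀
      u∈atom : atomSet I P j u ≡ true
      u∈atom = trans (cong (λ m → isAtom m j) u∈j) (dec-true (j Fin.≟ j) refl)
      cut-bound : 𝟙[ not (atomSet I P j w) ∧ plus I u w ] ℕ.≤ χcost u w ℕ.+ χadm u w
      cut-bound = 𝟙-≤ _ λ h →
        let w∉atom = not-injective (∧-conicalˡ _ _ h)
        in plusEdge-charged (λ u≡w → not-¬ (subst (λ x → atomSet I P j x ≡ true) u≡w u∈atom) w∉atom)
                            (trans (K-atom P w u∈j) w∉atom) (∧-conicalʳ _ _ h)
      inner-bound : 𝟙[ (u <V w) ∧ atomSet I P j w ∧ not (plus I u w) ] ℕ.≤ χcost u w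
      inner-bound = 𝟙-≤ _ λ h →
        let rest = ∧-conicalʳ (u <V w) (atomSet I P j w ∧ not (plus I u w)) h
        in minusEdge-charged (∧-conicalˡ _ _ h) (trans (K-atom P w u∈j) (∧-conicalˡ _ _ rest))
                             (not-injective (∧-conicalʳ _ _ rest))

  sum-symmetrised : ∀ (b : Fin n → Fin n → Bool) →
                    sumℕ² (λ u w → 𝟙[ b u w ] ℕ.+ 𝟙[ b w u ]) ≡ sumℕ² (λ u w → 𝟙[ b u w ]) ℕ.+ sumℕ² (λ u w → 𝟙[ b u w ])
  sum-symmetrised b = trans (sumℕ²-+ (λ u w → 𝟙[ b u w ]) (λ u w → 𝟙[ b w u ]))
                            (cong (sumℕ² (λ u w → 𝟙[ b u w ]) ℕ.+_) (sumℕ²-transpose (λ u w → 𝟙[ b u w ])))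

  totalCharge≤6cost+2numAdm : totalCharge P ℕ.≤ 6 ℕ.* clCost I cl ℕ.+ 2 ℕ.* numAdm I P
  totalCharge≤6cost+2numAdm = begin
    sumℕ² (singletonPair P) ℕ.+ sumℕ (atomCost P)
      ≡⟨ cong (sumℕ² (singletonPair P) ℕ.+_) atomCosts-by-pair ⟩
    sumℕ² (singletonPair P) ℕ.+ sumℕ² atomPairs
      ≡⟨ sumℕ²-+ (singletonPair P) atomPairs ⟨
    sumℕ² (λ u w → singletonPair P u w ℕ.+ atomPairs u w)
      ≡⟨ sumℕ-cong (λ u → sumℕ-cong (singletonPair+atomPairs≡charge P u)) ⟩
    sumℕ² (λ u w → charge P (atom u) u w)
      ≤⟨ sumℕ²-mono-≤ charge-bound ⟩
    sumℕ² (λ u w → 3 ℕ.* χcost u w ℕ.+ χadm u w)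
      ≡⟨ sumℕ²-+ (λ u w → 3 ℕ.* χcost u w) χadm ⟩
    sumℕ² (λ u w → 3 ℕ.* χcost u w) ℕ.+ sumℕ² χadm
      ≡⟨ cong₂ ℕ._+_ (trans (sumℕ²-*ˡ 3 χcost) (cong (3 ℕ.*_) (sum-symmetrised disagrees)))
                     (sum-symmetrised admissiblePair) ⟩
    3 ℕ.* (clCost I cl ℕ.+ clCost I cl) ℕ.+ (numAdm I P ℕ.+ numAdm I P)
      ≡⟨ 3[c+c]+[a+a]≡6c+2a (clCost I cl) (numAdm I P) ⟩
    6 ℕ.* clCost I cl ℕ.+ 2 ℕ.* numAdm I P ∎
    where
    open ℕ.≤-Reasoning
    atomPairs : Fin n → Fin n → ℕ
    atomPairs u w = sumℕ (λ i → atomPair P i u w)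
    atomCosts-by-pair : sumℕ (atomCost P) ≡ sumℕ² atomPairs
    atomCosts-by-pair = trans (sumℕ-cong (sym ∘ sum-atomPair P))
      (trans (sumℕ-comm (λ i u → sumℕ (atomPair P i u))) (sumℕ-cong (λ u → sumℕ-comm (λ i w → atomPair P i u w))))
    3[c+c]+[a+a]≡6c+2a : ∀ c a → 3 ℕ.* (c ℕ.+ c) ℕ.+ (a ℕ.+ a) ≡ 6 ℕ.* c ℕ.+ 2 ℕ.* a
    3[c+c]+[a+a]≡6c+2a = solve-∀

module _ {n} {I : Instance n} (P : Preclustering I) (ε : ℚ) (cl : Clustering I) (large : Large I P ε cl) where

  large⇒atoms-unbroken : ∀ u w → atomic I P u w ≡ true → cl u ≡ cl w
  large⇒atoms-unbroken u w atomic-uw = sym (≡ᵇ⇒≡ (proj₁ (large (cl u)) u w (dec-true (cl u Fin.≟ cl u) refl) atomic-uw))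

  large⇒clusters-admissible : ∀ u w → cl u ≡ cl w → atomic I P u w ≡ true ⊎ Preclustering.adm P u w ≡ true
  large⇒clusters-admissible u w joined =
    proj₁ (proj₂ (large (cl u))) u w (dec-true (cl u Fin.≟ cl u) refl) (dec-true (cl w Fin.≟ cl u) (sym joined))

  weighted-dCrossSet-bound : ∀ {x C₁} → 0ℚ ≤ x → x ≤ 1ℚ → x * toℚ (numAdm I P) ≤ C₁ * toℚ (clCost I cl) →
                             x * dCrossSet I P (λ _ → true) ≤ (toℚ 6 + toℚ 2 * C₁) * toℚ (clCost I cl)
  weighted-dCrossSet-bound {x} {C₁} 0≤x x≤1 x|Eadm|≤C₁cost = begin
    x * dCrossSet I P (λ _ → true)
      ≤⟨ *-monoˡ-≤-nonNeg′ 0≤x (≤-trans (dCrossSet-all≤totalCharge P) (toℚ-mono-≤ charged)) ⟩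
    x * toℚ (6 ℕ.* cc ℕ.+ 2 ℕ.* na)
      ≡⟨ cong (x *_) (toℚ-*-+-* 6 cc 2 na) ⟩
    x * (toℚ 6 * toℚ cc + toℚ 2 * toℚ na)
      ≡⟨ solve 3 (λ x c a → x :* (con (toℚ 6) :* c :+ con (toℚ 2) :* a)
                            := con (toℚ 6) :* (x :* c) :+ con (toℚ 2) :* (x :* a)) refl x (toℚ cc) (toℚ na) ⟩
    toℚ 6 * (x * toℚ cc) + toℚ 2 * (x * toℚ na)
      ≤⟨ +-mono-≤ (*-monoˡ-≤-nonNeg′ (toℚ-nonNeg 6) (*-≤-of-≤1 (toℚ-nonNeg cc) x≤1))
                  (*-monoˡ-≤-nonNeg′ (toℚ-nonNeg 2) x|Eadm|≤C₁cost) ⟩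
    toℚ 6 * toℚ cc + toℚ 2 * (C₁ * toℚ cc)
      ≡⟨ solve 2 (λ C c → con (toℚ 6) :* c :+ con (toℚ 2) :* (C :* c) := (con (toℚ 6) :+ con (toℚ 2) :* C) :* c)
                 refl C₁ (toℚ cc) ⟩
    (toℚ 6 + toℚ 2 * C₁) * toℚ cc ∎
    where
    open ≤-Reasoning
    cc = clCost I cl
    na = numAdm I P
    charged = ClusteringCharge.totalCharge≤6cost+2numAdm P cl large⇒atoms-unbroken large⇒clusters-admissible

ε[1+2c₀]≤1⇒ε≤1×2c₀ε≤1 : ∀ {c₀ ε} → 0ℚ ≤ c₀ → 0ℚ ≤ ε → ε * (1ℚ + toℚ 2 * c₀) ≤ 1ℚ → ε ≤ 1ℚ × toℚ 2 * (c₀ * ε) ≤ 1ℚ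
ε[1+2c₀]≤1⇒ε≤1×2c₀ε≤1 {c₀} {ε} 0≤c₀ 0≤ε εq≤1 =
  ≤-trans (≤-+-nonNeg 0≤2c₀ε) ε+2c₀ε≤1 ,
  ≤-trans (subst (toℚ 2 * (c₀ * ε) ≤_) (+-comm (toℚ 2 * (c₀ * ε)) ε) (≤-+-nonNeg 0≤ε)) ε+2c₀ε≤1
  where
  0≤2c₀ε : 0ℚ ≤ toℚ 2 * (c₀ * ε)
  0≤2c₀ε = *-nonNeg (toℚ-nonNeg 2) (*-nonNeg 0≤c₀ 0≤ε)
  ε+2c₀ε≤1 : ε + toℚ 2 * (c₀ * ε) ≤ 1ℚ
  ε+2c₀ε≤1 = subst (_≤ 1ℚ)
    (solve 2 (λ ε c → ε :* (con 1ℚ :+ con (toℚ 2) :* c) := ε :+ con (toℚ 2) :* (c :* ε)) refl ε c₀) εq≤1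

lemma3p1 : (c₀ : ℚ) → 0ℚ < c₀ →
    Σ ℚ λ ε₀ → 0ℚ < ε₀ × Σ ℚ λ c → 0ℚ < c ×
      ((∀ (ε : ℚ) → 0ℚ < ε → ε < ε₀ →
         ∀ {n} (I : Instance n) (P : Preclustering I) → Similar I P c₀ ε →
         ∀ (i : Fin (Preclustering.k P)) →
           (dCrossSet I P (atomSet I P i) ≡ toℚ 2 * cost I (atomSet I P i))
           × (c * pow ε 3 * toℚ (dAdmSet I P (atomSet I P i)) ≤ toℚ 2 * cost I (atomSet I P i)))
      × ((C₁ : ℚ) → 0ℚ < C₁ → Σ ℚ λ C₂ → 0ℚ < C₂ ×
         (∀ (ε : ℚ) → 0ℚ < ε → ε < ε₀ →
           ∀ {n} (I : Instance n) (P : Preclustering I) → Similar I P c₀ ε →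
           ∀ (opt : Clustering I) → Optimal I opt → Large I P ε opt →
           pow ε 12 * toℚ (numAdm I P) ≤ C₁ * toℚ (clCost I opt) →
           pow ε 12 * dCrossSet I P (λ _ → true) ≤ C₂ * toℚ (clCost I opt))))
lemma3p1 c₀ 0<c₀ = 1/ q , positive⁻¹ (1/ q) {{1/pos⇒pos q}} , ℤ.+ 1 / 12 , positive⁻¹ (ℤ.+ 1 / 12) ,
  (λ ε 0<ε ε<1/q I P (_ , simB , simC) i →
     dCrossSet-atom P i ,
     AdmissibleDegreeOfAtom.dAdmSet≤twice-cost P i c₀ ε (<⇒≤ 0<ε) (proj₁ (small 0<ε ε<1/q))
       (*-nonNeg (<⇒≤ 0<c₀) (<⇒≤ 0<ε)) (proj₂ (small 0<ε ε<1/q)) simB simC) ,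
  (λ C₁ 0<C₁ → toℚ 6 + toℚ 2 * C₁ ,
     <-≤-trans (positive⁻¹ (toℚ 6)) (≤-+-nonNeg (*-nonNeg (toℚ-nonNeg 2) (<⇒≤ 0<C₁))) ,
     λ ε 0<ε ε<1/q I P _ opt _ large →
       weighted-dCrossSet-bound P ε opt large {C₁ = C₁}
         (pow-nonNeg (<⇒≤ 0<ε) 12) (pow-≤1 (<⇒≤ 0<ε) (proj₁ (small 0<ε ε<1/q)) 12))
  where
  -- ε < 1/q gives ε ≤ 1 and 2c₀ε ≤ 1, which is all the smallness of ε that is used.
  q : ℚ
  q = 1ℚ + toℚ 2 * c₀
  instance
    q-positive : Positive q
    q-positive = positive (<-≤-trans (positive⁻¹ 1ℚ) (≤-+-nonNeg (*-nonNeg (toℚ-nonNeg 2) (<⇒≤ 0<c₀))))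
    q-nonZero : NonZero q
    q-nonZero = pos⇒nonZero q
  small : ∀ {ε} → 0ℚ < ε → ε < 1/ q → ε ≤ 1ℚ × toℚ 2 * (c₀ * ε) ≤ 1ℚ
  small {ε} 0<ε ε<1/q = ε[1+2c₀]≤1⇒ε≤1×2c₀ε≤1 (<⇒≤ 0<c₀) (<⇒≤ 0<ε)
    (<⇒≤ (subst (ε * q <_) (*-inverseˡ q) (*-monoˡ-<-pos q ε<1/q)))
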